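{- In the simplified concurrent algorithm described in the context, a conflict between a non-blocking non-spanning edge addition and a concurrent spanning edge removal that results in an edge recorded as non-spanning whose endpoints lie in different connected components of the maintained spanning forest is impossible.
   Context: Setting: a concurrent dynamic connectivity structure maintaining a spanning forest $F$ of an undirected graph via Euler Tour Trees, with a non-blocking query \texttt{connected(u, v)} (linearizable). Simplifying assumptions: all spanning-forest updates are done under one global lock (\texttt{blocking\_add\_edge}, \texttt{blocking\_remove\_edge}); all non-spanning edges are kept in one global concurrent multiset \texttt{non\_spanning\_edges}; threads never add the same edge concurrently. Each edge has a status in $\{\texttt{INITIAL}, \texttt{SPANNING}, \texttt{NON-SPANNING}, \texttt{REMOVED}\}$, initially \texttt{INITIAL}. A blocking removal of a spanning edge publishes a descriptor in a global field \texttt{remove\_op} with a slot \texttt{replacement} (initially \texttt{null}), then searches \texttt{non\_spanning\_edges} for a replacement edge (an edge reconnecting the two trees); while searching, any edge seen in status \texttt{INITIAL} is helped to be added (as replacement if suitable, otherwise as non-spanning if its endpoints are connected); it also uses any edge installed in its \texttt{replacement} slot; at the end it sets the slot to a value \texttt{DONE}, and if no replacement was found the tree is split. Non-blocking \texttt{add\_edge(e)}: (1) if $\texttt{connected}(e.u,e.v)$ is false, perform \texttt{blocking\_add\_edge(e)} and return; (2) insert $e$ into \texttt{non\_spanning\_edges}; (3) read \texttt{op := remove\_op}; if \texttt{op} is non-null and $e$ can be a replacement for \texttt{op}: if CAS(\texttt{op.replacement}, \texttt{null}, $e$) succeeds, remove $e$ from the multiset, CAS the status from \texttt{INITIAL}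 to \texttt{SPANNING}, and return; else if \texttt{op.replacement} $=$ \texttt{DONE}, remove $e$ from the multiset, perform \texttt{blocking\_add\_edge(e)} and return; (4) if $\texttt{connected}(e.u,e.v)$ is false, remove $e$ from the multiset and restart from (1); (5) if CAS(status, \texttt{INITIAL}, \texttt{NON-SPANNING}) succeeds return; otherwise (a concurrent writer used or helped add $e$) remove one copy of $e$ from the multiset and return. Non-blocking \texttt{remove\_edge(e)}: if status is \texttt{NON-SPANNING}, CAS it to \texttt{REMOVED} (restart on failure) and then delete $e$ from the multiset; if \texttt{SPANNING}, do \texttt{blocking\_remove\_edge}; if \texttt{REMOVED} or \texttt{INITIAL}, return. -}

module Defs where

-- An operational (interleaving) model of the simplified concurrent
-- dynamic-connectivity algorithm, restricted to the parts relevant to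
-- the interaction between non-blocking edge addition / removal and
-- (lock-protected) blocking spanning-edge removal.

open import Data.Nat using (ℕ; zero; suc; pred; _<_)
import Data.Nat as ℕ
open import Data.Fin using (Fin; _≟_)
open import Data.Bool using (Bool; true; false; if_then_else_; _∧_; _∨_; not)
open import Data.Maybe using (Maybe; just; nothing)
open import Data.Product using (_×_; _,_; proj₁; proj₂)
open import Data.Sum using (_⊎_)
open import Relation.Nullary using (¬_; does)
open import Relation.Binary.PropositionalEquality using (_≡_; _≢_)

data Status : Set where
  INITIAL SPANNING NONSPANNING REMOVED : Status

-- content of the 'replacement' slot of a removal descriptor
data Slot (m : ℕ) : Set where
  null : Slot m
  edge : Fin m → Slot m
  DONE : Slot m

upd : ∀ {A : Set} {k : ℕ} → (Fin k → A) → Fin k → A → Fin k → A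
upd f i x j = if does (j ≟ i) then x else f j

updℕ : ∀ {A : Set} → (ℕ → A) → ℕ → A → ℕ → A
updℕ f i x j = if does (j ℕ.≟ i) then x else f j

-- forest operations (a forest is the set of its edges)
without : ∀ {m} → (Fin m → Bool) → Fin m → Fin m → Bool
without F r e = F e ∧ not (does (e ≟ r))

with+ : ∀ {m} → (Fin m → Bool) → Fin m → Fin m → Bool
with+ F a e = F e ∨ does (e ≟ a)

-- multiset of (non-spanning) edges: multiplicity function
msInsert : ∀ {m} → (Fin m → ℕ) → Fin m → Fin m → ℕ
msInsert M e = upd M e (suc (M e))

-- remove one copy (no-op if absent)
msRemove : ∀ {m} → (Fin m → ℕ) → Fin m → Fin m → ℕ
msRemove M e = upd M e (pred (M e))

-- Thread-local program counters (with local variables)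

data Local (m : ℕ) : Set where
  idle : Local m
  -- non-blocking add_edge(e)
  a1   : Fin m → Local m                 -- step (1): connected query
  ablk : Fin m → Local m                 -- about to run blocking_add_edge(e)
  a2   : Fin m → Local m                 -- step (2): insert into multiset
  a3   : Fin m → Local m                 -- step (3): read remove_op
  a3c  : Fin m → ℕ → Fin m → Local m     -- step (3): have op = (descriptor d, removed edge r)
  a3s  : Fin m → Local m                 -- step (3): CAS succeeded, remove e from multiset
  a3t  : Fin m → Local m                 -- step (3): CAS status INITIAL -> SPANNING
  a3r  : Fin m → Local m                 -- step (3): slot DONE, remove e from multiset
  a4   : Fin m → Local m
  a5   : Fin m → Local m
  -- non-blocking remove_edge(e)
  r1   : Fin m → Local m
  r2   : Fin m → Local m                 -- delete e from the multiset
  -- blocking_remove_edge(r)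
  b0   : Fin m → Local m                 -- acquire global lock
  b1   : Fin m → Local m                 -- check status, publish descriptor
  bs   : Fin m → ℕ → (Fin m → Bool) → Local m   -- searching; set of already visited edges
  bf   : Fin m → Maybe (Fin m) → Local m        -- apply: replace or split, release

record State (m T : ℕ) : Set where
  field
    forest   : Fin m → Bool
    ms       : Fin m → ℕ             -- non_spanning_edges (multiset)
    status   : Fin m → Status
    removeOp : Maybe (ℕ × Fin m)     -- remove_op: descriptor id and the edge being removed
    slots    : ℕ → Slot m            -- replacement slot of each descriptor
    counter  : ℕ                     -- next fresh descriptor id
    lock     : Bool
    started  : Fin m → Bool          -- add_edge(e) already invoked (each edge object added once)
    threads  : Fin T → Local m

open State public

initState : ∀ {m T} → State m T
initState = record
  { forest = λ _ → false ; ms = λ _ → 0 ; status = λ _ → INITIAL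
  ; removeOp = nothing ; slots = λ _ → null ; counter = 0 ; lock = false
  ; started = λ _ → false ; threads = λ _ → idle }

-- The model, for a fixed multigraph on n vertices with m edge objects
-- (edge e joins proj₁ (ends e) and proj₂ (ends e)) and T threads.

module Model {n m : ℕ} (ends : Fin m → Fin n × Fin n) (T : ℕ) where

  src tgt : Fin m → Fin n
  src e = proj₁ (ends e)
  tgt e = proj₂ (ends e)

  data Conn (F : Fin m → Bool) : Fin n → Fin n → Set where
    here : ∀ {u} → Conn F u u
    step : ∀ {u v w} (e : Fin m) → F e ≡ true →
           (ends e ≡ (u , v) ⊎ ends e ≡ (v , u)) → Conn F v w → Conn F u w

  Connected : (Fin m → Bool) → Fin m → Set
  Connected F e = Conn F (src e) (tgt e)

  -- e can be a replacement for the removal of r from F: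
  -- e reconnects the two trees obtained by cutting r.
  CanReplace : (Fin m → Bool) → Fin m → Fin m → Set
  CanReplace F r e = Connected F e × ¬ Connected (without F r) e

  S : Set
  S = State m T

  setT : S → Fin T → Local m → Fin T → Local m
  setT s i l = upd (threads s) i l

  data Step (s : S) : S → Set where
    invAdd : ∀ i e → threads s i ≡ idle → started s e ≡ false →
      Step s record s { started = upd (started s) e true ; threads = setT s i (a1 e) }
    invRem : ∀ i e → threads s i ≡ idle →
      Step s record s { threads = setT s i (r1 e) }
    a1-no  : ∀ i e → threads s i ≡ a1 e → ¬ Connected (forest s) e →
      Step s record s { threads = setT s i (ablk e) }
    a1-yes : ∀ i e → threads s i ≡ a1 e → Connected (forest s) e →
      Step s record s { threads = setT s i (a2 e) }
    -- blocking_add_edge(e), executed atomically under the global lock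
    blk-done : ∀ i e → threads s i ≡ ablk e → lock s ≡ false → status s e ≢ INITIAL →
      Step s record s { threads = setT s i idle }
    blk-span : ∀ i e → threads s i ≡ ablk e → lock s ≡ false → status s e ≡ INITIAL →
      ¬ Connected (forest s) e →
      Step s record s { forest = with+ (forest s) e ; status = upd (status s) e SPANNING
                      ; threads = setT s i idle }
    blk-nonspan : ∀ i e → threads s i ≡ ablk e → lock s ≡ false → status s e ≡ INITIAL →
      Connected (forest s) e →
      Step s record s { ms = msInsert (ms s) e ; status = upd (status s) e NONSPANNING
                      ; threads = setT s i idle }
    a2-ins : ∀ i e → threads s i ≡ a2 e →
      Step s record s { ms = msInsert (ms s) e ; threads = setT s i (a3 e) }
    a3-null : ∀ i e → threads s i ≡ a3 e → removeOp s ≡ nothing →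
      Step s record s { threads = setT s i (a4 e) }
    a3-op : ∀ i e d r → threads s i ≡ a3 e → removeOp s ≡ just (d , r) →
      Step s record s { threads = setT s i (a3c e d r) }
    a3-norepl : ∀ i e d r → threads s i ≡ a3c e d r → ¬ CanReplace (forest s) r e →
      Step s record s { threads = setT s i (a4 e) }
    a3-cas-ok : ∀ i e d r → threads s i ≡ a3c e d r → CanReplace (forest s) r e →
      slots s d ≡ null →
      Step s record s { slots = updℕ (slots s) d (edge e) ; threads = setT s i (a3s e) }
    a3-cas-done : ∀ i e d r → threads s i ≡ a3c e d r → CanReplace (forest s) r e →
      slots s d ≡ DONE →
      Step s record s { threads = setT s i (a3r e) }
    a3-cas-other : ∀ i e d r e' → threads s i ≡ a3c e d r → CanReplace (forest s) r e →
      slots s d ≡ edge e' →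
      Step s record s { threads = setT s i (a4 e) }
    a3s-rem : ∀ i e → threads s i ≡ a3s e →
      Step s record s { ms = msRemove (ms s) e ; threads = setT s i (a3t e) }
    a3t-ok : ∀ i e → threads s i ≡ a3t e → status s e ≡ INITIAL →
      Step s record s { status = upd (status s) e SPANNING ; threads = setT s i idle }
    a3t-fail : ∀ i e → threads s i ≡ a3t e → status s e ≢ INITIAL →
      Step s record s { threads = setT s i idle }
    a3r-rem : ∀ i e → threads s i ≡ a3r e →
      Step s record s { ms = msRemove (ms s) e ; threads = setT s i (ablk e) }
    a4-no : ∀ i e → threads s i ≡ a4 e → ¬ Connected (forest s) e →
      Step s record s { ms = msRemove (ms s) e ; threads = setT s i (a1 e) }
    a4-yes : ∀ i e → threads s i ≡ a4 e → Connected (forest s) e →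
      Step s record s { threads = setT s i (a5 e) }
    a5-ok : ∀ i e → threads s i ≡ a5 e → status s e ≡ INITIAL →
      Step s record s { status = upd (status s) e NONSPANNING ; threads = setT s i idle }
    a5-fail : ∀ i e → threads s i ≡ a5 e → status s e ≢ INITIAL →
      Step s record s { ms = msRemove (ms s) e ; threads = setT s i idle }
    r1-ns : ∀ i e → threads s i ≡ r1 e → status s e ≡ NONSPANNING →
      Step s record s { status = upd (status s) e REMOVED ; threads = setT s i (r2 e) }
    r1-sp : ∀ i e → threads s i ≡ r1 e → status s e ≡ SPANNING →
      Step s record s { threads = setT s i (b0 e) }
    r1-init : ∀ i e → threads s i ≡ r1 e → status s e ≡ INITIAL →
      Step s record s { threads = setT s i idle }
    r1-rem : ∀ i e → threads s i ≡ r1 e → status s e ≡ REMOVED →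
      Step s record s { threads = setT s i idle }
    r2-del : ∀ i e → threads s i ≡ r2 e →
      Step s record s { ms = msRemove (ms s) e ; threads = setT s i idle }
    b0-lock : ∀ i r → threads s i ≡ b0 r → lock s ≡ false →
      Step s record s { lock = true ; threads = setT s i (b1 r) }
    b1-gone : ∀ i r → threads s i ≡ b1 r → status s r ≢ SPANNING →
      Step s record s { lock = false ; threads = setT s i idle }
    b1-publish : ∀ i r → threads s i ≡ b1 r → status s r ≡ SPANNING →
      Step s record s { removeOp = just (counter s , r)
                      ; slots = updℕ (slots s) (counter s) null
                      ; counter = suc (counter s)
                      ; threads = setT s i (bs r (counter s) (λ _ → false)) }
    -- search: visit an unvisited edge of the multiset (while no replacement is in the slot)
    bs-absent : ∀ i r d V e → threads s i ≡ bs r d V → slots s d ≡ null → V e ≡ false →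
      ms s e ≡ 0 →
      Step s record s { threads = setT s i (bs r d (upd V e true)) }
    bs-init-repl : ∀ i r d V e → threads s i ≡ bs r d V → slots s d ≡ null → V e ≡ false →
      0 < ms s e → status s e ≡ INITIAL → CanReplace (forest s) r e →
      Step s record s { status = upd (status s) e SPANNING
                      ; slots = updℕ (slots s) d (edge e)
                      ; threads = setT s i (bs r d (upd V e true)) }
    bs-init-ns : ∀ i r d V e → threads s i ≡ bs r d V → slots s d ≡ null → V e ≡ false →
      0 < ms s e → status s e ≡ INITIAL → ¬ CanReplace (forest s) r e →
      Connected (forest s) e →
      Step s record s { status = upd (status s) e NONSPANNING
                      ; ms = msInsert (ms s) e
                      ; threads = setT s i (bs r d (upd V e true)) }
    bs-init-skip : ∀ i r d V e → threads s i ≡ bs r d V → slots s d ≡ null → V e ≡ false →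
      0 < ms s e → status s e ≡ INITIAL → ¬ CanReplace (forest s) r e →
      ¬ Connected (forest s) e →
      Step s record s { threads = setT s i (bs r d (upd V e true)) }
    bs-ns-repl : ∀ i r d V e → threads s i ≡ bs r d V → slots s d ≡ null → V e ≡ false →
      0 < ms s e → status s e ≡ NONSPANNING → CanReplace (forest s) r e →
      Step s record s { status = upd (status s) e SPANNING
                      ; ms = msRemove (ms s) e
                      ; slots = updℕ (slots s) d (edge e)
                      ; threads = setT s i (bs r d (upd V e true)) }
    bs-ns-skip : ∀ i r d V e → threads s i ≡ bs r d V → slots s d ≡ null → V e ≡ false →
      0 < ms s e → status s e ≡ NONSPANNING → ¬ CanReplace (forest s) r e →
      Step s record s { threads = setT s i (bs r d (upd V e true)) }
    bs-other : ∀ i r d V e → threads s i ≡ bs r d V → slots s d ≡ null → V e ≡ false →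
      0 < ms s e → (status s e ≡ SPANNING ⊎ status s e ≡ REMOVED) →
      Step s record s { threads = setT s i (bs r d (upd V e true)) }
    -- end of search: set the slot to DONE, taking any edge installed there
    bs-end-none : ∀ i r d V → threads s i ≡ bs r d V → slots s d ≡ null →
      (∀ e → V e ≡ true) →
      Step s record s { slots = updℕ (slots s) d DONE ; threads = setT s i (bf r nothing) }
    bs-end-repl : ∀ i r d V e → threads s i ≡ bs r d V → slots s d ≡ edge e →
      Step s record s { slots = updℕ (slots s) d DONE ; threads = setT s i (bf r (just e)) }
    bf-repl : ∀ i r e → threads s i ≡ bf r (just e) →
      Step s record s { forest = with+ (without (forest s) r) e
                      ; status = upd (status s) r REMOVED
                      ; removeOp = nothing ; lock = false ; threads = setT s i idle }
    bf-split : ∀ i r → threads s i ≡ bf r nothing →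
      Step s record s { forest = without (forest s) r
                      ; status = upd (status s) r REMOVED
                      ; removeOp = nothing ; lock = false ; threads = setT s i idle }

  data Reachable : S → Set where
    init : Reachable initState
    next : ∀ {s s'} → Reachable s → Step s s' → Reachable s'

{-# OPTIONS --safe #-}

-- A non-spanning mark is only written while the endpoints of the edge are connected, so it can only be
-- invalidated when the forest loses an edge r. Exchanging r for a replacement edge keeps every connection.
-- Otherwise the removal of r has scanned all of non_spanning_edges before splitting the tree, and every
-- scanned edge that is non-spanning, or is still INITIAL but may be marked by an adder that never consults
-- this removal's descriptor, was found not to reconnect the two sides; since connectivity in a finite
-- forest is decidable, its endpoints stay connected without r. An edge with no copy in the multiset is in
-- neither situation, because every non-spanning mark and every adder between steps (2) and (5) owns a
-- distinct copy of it.

module Submission where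

open import Defs
open import Data.Bool using (Bool; true; false; if_then_else_)
open import Data.Bool.Properties using () renaming (_≟_ to _≟ᵇ_)
open import Data.Empty using (⊥; ⊥-elim)
open import Data.Maybe using (Maybe; just; nothing)
open import Data.Fin using (Fin; _≟_; punchIn) renaming (zero to fzero; suc to fsuc)
open import Data.Fin.Properties using (injective⇒≤; punchInᵢ≢i; any?)
open import Data.List using (List; []; _∷_; length; lookup)
open import Data.List.Membership.Propositional using (_∈_)
open import Data.List.Membership.Propositional.Properties using (∈-lookup)
open import Data.List.Relation.Unary.All as All using ([]; _∷_)
open import Data.List.Relation.Unary.All.Properties using (¬Any⇒All¬)
open import Data.List.Relation.Unary.Any using (here; there) renaming (any? to anyᴸ?)
open import Data.List.Relation.Unary.Unique.Propositional using (Unique; []; _∷_)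
open import Data.Nat using (ℕ; zero; suc; pred; _+_; _≤_; _<_; z≤n; s≤s) renaming (_≟_ to _≟ℕ_)
open import Data.Nat.Properties
  using (≤-refl; ≤-trans; ≤-reflexive; <⇒≤; <-irrefl; m<n⇒m<1+n; n≮0; m≤m+n; m≤n+m; m≤n+m∸n; +-identityʳ; +-assoc;
         +-cancelʳ-≤; +-monoˡ-≤; +-monoʳ-≤; +-0-commutativeMonoid; module ≤-Reasoning)
open import Algebra.Properties.CommutativeMonoid.Sum +-0-commutativeMonoid
  using (sum; sum-remove; sum-cong-≗; sum-replicate-zero)
open import Data.Nat.Solver using (module +-*-Solver)
open import Data.Product using (_×_; _,_; proj₁; proj₂; Σ; ∃-syntax)
open import Data.Sum using (_⊎_; inj₁; inj₂; [_,_]′)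
open import Data.Unit using (⊤; tt)
open import Function using (_∘_; id; case_of_)
open import Relation.Nullary using (¬_; Dec; yes; no; does)
open import Relation.Nullary.Decidable using (dec-true; dec-false; decidable-stable; map′; _×-dec_; _⊎-dec_)
open import Relation.Binary.PropositionalEquality

upd-same : ∀ {A : Set} {k} (f : Fin k → A) i x → upd f i x i ≡ x
upd-same f i x rewrite dec-true (i ≟ i) refl = refl

upd-other : ∀ {A : Set} {k} (f : Fin k → A) {i} x {j} → j ≢ i → upd f i x j ≡ f j
upd-other f {i} x {j} j≢i rewrite dec-false (j ≟ i) j≢i = refl

upd-reflects : ∀ {A : Set} {k} (f : Fin k → A) i {x y} j → x ≢ y → upd f i x j ≡ y → f j ≡ y
upd-reflects f i j x≢y eq with j ≟ i
... | yes _ = ⊥-elim (x≢y eq)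
... | no _ = eq

updℕ-same : ∀ {A : Set} (f : ℕ → A) i x → updℕ f i x i ≡ x
updℕ-same f i x rewrite dec-true (i ≟ℕ i) refl = refl

updℕ-other : ∀ {A : Set} (f : ℕ → A) {i} x {j} → j ≢ i → updℕ f i x j ≡ f j
updℕ-other f {i} x {j} j≢i rewrite dec-false (j ≟ℕ i) j≢i = refl

≤-sum : ∀ {k} (f : Fin k → ℕ) i → f i ≤ sum f
≤-sum {suc k} f i = ≤-trans (m≤m+n (f i) _) (≤-reflexive (sym (sum-remove f)))

sum-update : ∀ {k} (f g : Fin k → ℕ) i → (∀ j → j ≢ i → g j ≡ f j) → sum g + f i ≡ sum f + g i
sum-update {suc k} f g i g≈f = begin
  sum g + f i                              ≡⟨ cong (_+ f i) (sum-remove g) ⟩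
  g i + sum (g ∘ punchIn i) + f i          ≡⟨ cong (λ x → g i + x + f i) rest ⟩
  g i + sum (f ∘ punchIn i) + f i          ≡⟨ solve 3 (λ a b c → a :+ b :+ c := c :+ b :+ a) refl (g i) _ (f i) ⟩
  f i + sum (f ∘ punchIn i) + g i          ≡⟨ cong (_+ g i) (sum-remove f) ⟨
  sum f + g i                              ∎
  where
    open ≡-Reasoning
    open +-*-Solver
    rest : sum (g ∘ punchIn i) ≡ sum (f ∘ punchIn i)
    rest = sum-cong-≗ (λ j → g≈f (punchIn i j) (punchInᵢ≢i i j))

≤-transfer : ∀ a′ A′ h a A h′ μ μ′ → A′ + h ≡ A + h′ → a + A ≤ μ → a′ + h′ + μ ≤ a + h + μ′ →
             a′ + A′ ≤ μ′
≤-transfer a′ A′ h a A h′ μ μ′ eq A≤μ local = +-cancelʳ-≤ (h + μ) (a′ + A′) μ′ (begin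
  a′ + A′ + (h + μ)   ≡⟨ solve 4 (λ a b c d → a :+ b :+ (c :+ d) := a :+ (b :+ c) :+ d) refl a′ A′ h μ ⟩
  a′ + (A′ + h) + μ   ≡⟨ cong (λ z → a′ + z + μ) eq ⟩
  a′ + (A + h′) + μ   ≡⟨ solve 4 (λ a b c d → a :+ (b :+ c) :+ d := a :+ c :+ d :+ b) refl a′ A h′ μ ⟩
  a′ + h′ + μ + A     ≤⟨ +-monoˡ-≤ A local ⟩
  a + h + μ′ + A      ≡⟨ solve 4 (λ a b c d → a :+ b :+ c :+ d := a :+ d :+ (b :+ c)) refl a h μ′ A ⟩
  a + A + (h + μ′)    ≤⟨ +-monoˡ-≤ (h + μ′) A≤μ ⟩
  μ + (h + μ′)        ≡⟨ solve 3 (λ a b c → a :+ (b :+ c) := c :+ (b :+ a)) refl μ h μ′ ⟩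
  μ′ + (h + μ)        ∎)
  where
    open ≤-Reasoning
    open +-*-Solver

+0-≤ : ∀ a b c d → a + b ≤ c + d → a + 0 + b ≤ c + 0 + d
+0-≤ a b c d le rewrite +-identityʳ a | +-identityʳ c = le

copy-released : ∀ a b → a + 0 + b ≤ a + 1 + pred b
copy-released a b = begin
  a + 0 + b         ≡⟨ cong (_+ b) (+-identityʳ a) ⟩
  a + b             ≤⟨ +-monoʳ-≤ a (m≤n+m∸n b 1) ⟩
  a + (1 + pred b)  ≡⟨ +-assoc a 1 (pred b) ⟨
  a + 1 + pred b    ∎
  where open ≤-Reasoning

copy-inserted : ∀ a b → a + 1 + b ≤ a + 0 + suc b
copy-inserted a b = ≤-reflexive (begin
  a + 1 + b   ≡⟨ +-assoc a 1 b ⟩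
  a + suc b   ≡⟨ cong (_+ suc b) (+-identityʳ a) ⟨
  a + 0 + suc b ∎)
  where open ≡-Reasoning

module _ {n m : ℕ} (ends : Fin m → Fin n × Fin n) (T : ℕ) where
  open Model ends T

  -- Connectivity in a forest

  Joins : Fin m → Fin n → Fin n → Set
  Joins e u v = ends e ≡ (u , v) ⊎ ends e ≡ (v , u)

  Joins-sym : ∀ {e u v} → Joins e u v → Joins e v u
  Joins-sym (inj₁ eq) = inj₂ eq
  Joins-sym (inj₂ eq) = inj₁ eq

  Conn-edge : ∀ {F u v} e → F e ≡ true → Joins e u v → Conn F u v
  Conn-edge e Fe j = step e Fe j here

  Conn-trans : ∀ {F u v w} → Conn F u v → Conn F v w → Conn F u w
  Conn-trans here q = q
  Conn-trans (step e Fe j p) q = step e Fe j (Conn-trans p q)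

  Conn-sym : ∀ {F u v} → Conn F u v → Conn F v u
  Conn-sym here = here
  Conn-sym (step e Fe j p) = Conn-trans (Conn-sym p) (Conn-edge e Fe (Joins-sym j))

  Conn-mono : ∀ {F G : Fin m → Bool} → (∀ e → F e ≡ true → G e ≡ true) →
              ∀ {u v} → Conn F u v → Conn G u v
  Conn-mono F⊆G here = here
  Conn-mono F⊆G (step e Fe j p) = step e (F⊆G e Fe) j (Conn-mono F⊆G p)

  Conn-ends : ∀ {F e u v} → Conn F (src e) (tgt e) → Joins e u v → Conn F u v
  Conn-ends c (inj₁ refl) = c
  Conn-ends c (inj₂ refl) = Conn-sym c

  without-kept : ∀ (F : Fin m → Bool) r {f} → F f ≡ true → f ≢ r → without F r f ≡ true
  without-kept F r {f} Ff f≢r rewrite Ff | dec-false (f ≟ r) f≢r = refl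

  with+-⊇ : ∀ (F : Fin m → Bool) a f → F f ≡ true → with+ F a f ≡ true
  with+-⊇ F a f Ff rewrite Ff = refl

  with+-added : ∀ (F : Fin m → Bool) a → with+ F a a ≡ true
  with+-added F a rewrite dec-true (a ≟ a) refl with F a
  ... | true = refl
  ... | false = refl

  IsEnd : Fin m → Fin n → Set
  IsEnd r u = u ≡ src r ⊎ u ≡ tgt r

  Joins-start : ∀ {r u v} → Joins r u v → IsEnd r u
  Joins-start (inj₁ eq) = inj₁ (cong proj₁ (sym eq))
  Joins-start (inj₂ eq) = inj₂ (cong proj₂ (sym eq))

  Joins-end : ∀ {r u v} → Joins r u v → IsEnd r v
  Joins-end = Joins-start ∘ Joins-sym

  Conn-until : ∀ {F} r {a b} → Conn F a b →
               Conn (without F r) a b ⊎ ∃[ u ] IsEnd r u × Conn (without F r) a u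
  Conn-until r here = inj₁ here
  Conn-until {F} r (step f Ff j p) with f ≟ r
  ... | yes refl = inj₂ (_ , Joins-start j , here)
  ... | no f≢r with Conn-until r p
  ...   | inj₁ q = inj₁ (step f (without-kept F r Ff f≢r) j q)
  ...   | inj₂ (u , u-end , q) = inj₂ (u , u-end , step f (without-kept F r Ff f≢r) j q)

  Conn-after : ∀ {F} r {a b} → Conn F a b →
               Conn (without F r) a b ⊎ ∃[ u ] IsEnd r u × Conn (without F r) u b
  Conn-after r here = inj₁ here
  Conn-after {F} r (step f Ff j p) with Conn-after r p
  ... | inj₂ found = inj₂ found
  ... | inj₁ q with f ≟ r
  ...   | yes refl = inj₂ (_ , Joins-end j , q)
  ...   | no f≢r = inj₁ (step f (without-kept F r Ff f≢r) j q)

  Conn-across : ∀ {F e u v} → F e ≡ true → Conn F (src e) u → Conn F v (tgt e) → Conn F u v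
  Conn-across {e = e} Fe p q = Conn-trans (Conn-sym p) (Conn-trans (Conn-edge e Fe (inj₁ refl)) (Conn-sym q))

  replacement-reconnects : ∀ {F r e} → CanReplace F r e → Conn (with+ (without F r) e) (src r) (tgt r)
  replacement-reconnects {F} {r} {e} (c , ¬c′) with Conn-until r c | Conn-after r c
  ... | inj₁ c′ | _ = ⊥-elim (¬c′ c′)
  ... | _ | inj₁ c′ = ⊥-elim (¬c′ c′)
  ... | inj₂ (_ , inj₁ refl , p) | inj₂ (_ , inj₂ refl , q) =
    Conn-across (with+-added (without F r) e) (Conn-mono (with+-⊇ (without F r) e) p)
                                             (Conn-mono (with+-⊇ (without F r) e) q)
  ... | inj₂ (_ , inj₂ refl , p) | inj₂ (_ , inj₁ refl , q) = Conn-sym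
    (Conn-across (with+-added (without F r) e) (Conn-mono (with+-⊇ (without F r) e) p)
                                              (Conn-mono (with+-⊇ (without F r) e) q))
  ... | inj₂ (_ , inj₁ refl , p) | inj₂ (_ , inj₁ refl , q) = ⊥-elim (¬c′ (Conn-trans p q))
  ... | inj₂ (_ , inj₂ refl , p) | inj₂ (_ , inj₂ refl , q) = ⊥-elim (¬c′ (Conn-trans p q))

  Conn-replace : ∀ {F r e} → CanReplace F r e → ∀ {a b} → Conn F a b → Conn (with+ (without F r) e) a b
  Conn-replace cr here = here
  Conn-replace {F} {r} {e} cr (step f Ff j p) with f ≟ r
  ... | yes refl = Conn-trans (Conn-ends (replacement-reconnects cr) j) (Conn-replace cr p)
  ... | no f≢r = step f (with+-⊇ (without F r) e f (without-kept F r Ff f≢r)) j (Conn-replace cr p)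

  size : ∀ {F u v} → Conn F u v → ℕ
  size here = 0
  size (step _ _ _ p) = suc (size p)

  vertices : ∀ {F u v} → Conn F u v → List (Fin n)
  vertices {u = u} here = u ∷ []
  vertices {u = u} (step _ _ _ p) = u ∷ vertices p

  length-vertices : ∀ {F u v} (p : Conn F u v) → length (vertices p) ≡ suc (size p)
  length-vertices here = refl
  length-vertices (step _ _ _ p) = cong suc (length-vertices p)

  SimpleConn : (Fin m → Bool) → Fin n → Fin n → Set
  SimpleConn F u v = Σ (Conn F u v) (Unique ∘ vertices)

  SimpleConn-suffix : ∀ {F w v x} (p : Conn F w v) → x ∈ vertices p → Unique (vertices p) →
                      SimpleConn F x v
  SimpleConn-suffix here (here refl) u = here , u
  SimpleConn-suffix (step f Ff j p) (here refl) u = step f Ff j p , u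
  SimpleConn-suffix (step f Ff j p) (there x∈) (_ ∷ u) = SimpleConn-suffix p x∈ u

  Conn⇒SimpleConn : ∀ {F u v} → Conn F u v → SimpleConn F u v
  Conn⇒SimpleConn here = here , ([] ∷ [])
  Conn⇒SimpleConn {u = u} (step f Ff j p) with Conn⇒SimpleConn p
  ... | q , q-simple with anyᴸ? (u ≟_) (vertices q)
  ...   | yes u∈ = SimpleConn-suffix q u∈ q-simple
  ...   | no u∉ = step f Ff j q , (¬Any⇒All¬ _ u∉ ∷ q-simple)

  lookup-injective : ∀ {xs : List (Fin n)} → Unique xs → ∀ {i j} → lookup xs i ≡ lookup xs j → i ≡ j
  lookup-injective (_ ∷ _) {fzero} {fzero} _ = refl
  lookup-injective (x∉ ∷ _) {fzero} {fsuc j} eq = ⊥-elim (All.lookup x∉ (∈-lookup j) eq)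
  lookup-injective (x∉ ∷ _) {fsuc i} {fzero} eq = ⊥-elim (All.lookup x∉ (∈-lookup i) (sym eq))
  lookup-injective (_ ∷ u) {fsuc i} {fsuc j} eq = cong fsuc (lookup-injective u eq)

  Unique-length : ∀ {xs : List (Fin n)} → Unique xs → length xs ≤ n
  Unique-length u = injective⇒≤ (lookup-injective u)

  simple-size : ∀ {F u v} (p : Conn F u v) → Unique (vertices p) → size p < n
  simple-size p u = ≤-trans (≤-reflexive (sym (length-vertices p))) (Unique-length u)

  Conn≤ : (Fin m → Bool) → ℕ → Fin n → Fin n → Set
  Conn≤ F k u v = Σ (Conn F u v) λ p → size p ≤ k

  Conn≤? : ∀ F k u v → Dec (Conn≤ F k u v)
  Conn≤? F zero u v = map′ (λ { refl → here , z≤n }) (λ { (here , _) → refl ; (step _ _ _ _ , ()) }) (u ≟ v)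
  Conn≤? F (suc k) u v = map′ to from
    (u ≟ v ⊎-dec any? λ f → (F f ≟ᵇ true) ×-dec ((src f ≟ u ×-dec Conn≤? F k (tgt f) v)
                                                ⊎-dec (tgt f ≟ u ×-dec Conn≤? F k (src f) v)))
    where
    to : _ → Conn≤ F (suc k) u v
    to (inj₁ refl) = here , z≤n
    to (inj₂ (f , Ff , inj₁ (refl , p , p≤k))) = step f Ff (inj₁ refl) p , s≤s p≤k
    to (inj₂ (f , Ff , inj₂ (refl , p , p≤k))) = step f Ff (inj₂ refl) p , s≤s p≤k
    from : Conn≤ F (suc k) u v → _
    from (here , _) = inj₁ refl
    from (step f Ff (inj₁ eq) p , s≤s p≤k) =
      inj₂ (f , Ff , inj₁ (cong proj₁ eq , subst (λ w → Conn≤ F k w v) (sym (cong proj₂ eq)) (p , p≤k)))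
    from (step f Ff (inj₂ eq) p , s≤s p≤k) =
      inj₂ (f , Ff , inj₂ (cong proj₂ eq , subst (λ w → Conn≤ F k w v) (sym (cong proj₁ eq)) (p , p≤k)))

  Conn? : ∀ F u v → Dec (Conn F u v)
  Conn? F u v = map′ proj₁ shorten (Conn≤? F n u v)
    where
    shorten : Conn F u v → Conn≤ F n u v
    shorten c with Conn⇒SimpleConn c
    ... | p , p-simple = p , <⇒≤ (simple-size p p-simple)

  Survives : (Fin m → Bool) → Fin m → Fin m → Set
  Survives F r e = Connected F e → Connected (without F r) e

  ¬CanReplace⇒Survives : ∀ F r e → ¬ CanReplace F r e → Survives F r e
  ¬CanReplace⇒Survives F r e ¬cr c = decidable-stable (Conn? (without F r) (src e) (tgt e)) (λ ¬c′ → ¬cr (c , ¬c′))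

  -- The invariant

  InCritical : Local m → Set
  InCritical (b1 _) = ⊤
  InCritical (bs _ _ _) = ⊤
  InCritical (bf _ _) = ⊤
  InCritical _ = ⊥

  -- the copy in non_spanning_edges that the thread has inserted, or is about to delete
  heldEdge : Local m → Maybe (Fin m)
  heldEdge (a3 e) = just e
  heldEdge (a3c e _ _) = just e
  heldEdge (a3s e) = just e
  heldEdge (a3r e) = just e
  heldEdge (a4 e) = just e
  heldEdge (a5 e) = just e
  heldEdge (r2 e) = just e
  heldEdge _ = nothing

  copies : Fin m → Maybe (Fin m) → ℕ
  copies e nothing = 0
  copies e (just e′) = if does (e′ ≟ e) then 1 else 0

  copies-self : ∀ e → copies e (just e) ≡ 1
  copies-self e rewrite dec-true (e ≟ e) refl = refl

  copies-other : ∀ {e e′} → e′ ≢ e → copies e (just e′) ≡ 0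
  copies-other {e} {e′} e′≢e rewrite dec-false (e′ ≟ e) e′≢e = refl

  holds : Fin m → Local m → ℕ
  holds e l = copies e (heldEdge l)

  nonSpanning : Status → ℕ
  nonSpanning NONSPANNING = 1
  nonSpanning _ = 0

  nonSpanning-upd-≤ : ∀ (St : Fin m → Status) e {X} → X ≢ NONSPANNING →
                      ∀ x → nonSpanning (upd St e X x) ≤ nonSpanning (St x)
  nonSpanning-upd-≤ St e {X} X≢NS x with x ≟ e | X
  ... | no _ | _ = ≤-refl
  ... | yes _ | INITIAL = z≤n
  ... | yes _ | SPANNING = z≤n
  ... | yes _ | NONSPANNING = ⊥-elim (X≢NS refl)
  ... | yes _ | REMOVED = z≤n

  claims : S → Fin m → ℕ
  claims s e = nonSpanning (status s e) + sum (λ j → holds e (threads s j))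

  -- The thread may still mark e non-spanning without consulting descriptor d.
  Bypasses : ℕ → Fin m → Local m → Set
  Bypasses d e (a4 e′) = e′ ≡ e
  Bypasses d e (a5 e′) = e′ ≡ e
  Bypasses d e (a3c e′ d′ _) = e′ ≡ e × d′ ≢ d
  Bypasses d e _ = ⊥

  EdgeSafe : (Fin m → Status) → (Fin m → Bool) → (Fin T → Local m) → ℕ → Fin m → Fin m → Set
  EdgeSafe St F Th d r e =
    (St e ≡ NONSPANNING → Survives F r e) × (St e ≡ INITIAL → ∀ j → Bypasses d e (Th j) → Survives F r e)

  SafeVisits : (Fin m → Status) → (Fin m → Bool) → (Fin T → Local m) → ℕ → Fin m → (Fin m → Bool) → Set
  SafeVisits St F Th d r V = ∀ e → V e ≡ true → EdgeSafe St F Th d r e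

  SafeOutcome : S → ℕ → Fin m → Maybe (Fin m) → Set
  SafeOutcome s d r nothing = SafeVisits (status s) (forest s) (threads s) d r (λ _ → true)
  SafeOutcome s d r (just e) = CanReplace (forest s) r e

  LocalInv : S → Local m → Set
  LocalInv s (a5 e) = status s e ≡ INITIAL → Connected (forest s) e
  LocalInv s (a3c e d r) = d < counter s × (∀ r′ → removeOp s ≡ just (d , r′) → r′ ≡ r)
  LocalInv s (bs r d V) =
    removeOp s ≡ just (d , r) ×
    (slots s d ≡ null → SafeVisits (status s) (forest s) (threads s) d r V) ×
    (∀ e → slots s d ≡ edge e → CanReplace (forest s) r e)
  LocalInv s (bf r x) = ∃[ d ] removeOp s ≡ just (d , r) × slots s d ≡ DONE × SafeOutcome s d r x
  LocalInv s _ = ⊤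

  LocalInv-transfer : ∀ {s s′ : S} l →
    (∀ e → l ≡ a5 e → LocalInv s (a5 e) → LocalInv s′ (a5 e)) →
    (∀ e d r → l ≡ a3c e d r → LocalInv s (a3c e d r) → LocalInv s′ (a3c e d r)) →
    (∀ r d V → l ≡ bs r d V → LocalInv s (bs r d V) → LocalInv s′ (bs r d V)) →
    (∀ r x → l ≡ bf r x → LocalInv s (bf r x) → LocalInv s′ (bf r x)) →
    LocalInv s l → LocalInv s′ l
  LocalInv-transfer (a5 e) h _ _ _ = h e refl
  LocalInv-transfer (a3c e d r) _ h _ _ = h e d r refl
  LocalInv-transfer (bs r d V) _ _ h _ = h r d V refl
  LocalInv-transfer (bf r x) _ _ _ h = h r x refl
  LocalInv-transfer idle _ _ _ _ _ = tt
  LocalInv-transfer (a1 _) _ _ _ _ _ = tt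
  LocalInv-transfer (ablk _) _ _ _ _ _ = tt
  LocalInv-transfer (a2 _) _ _ _ _ _ = tt
  LocalInv-transfer (a3 _) _ _ _ _ _ = tt
  LocalInv-transfer (a3s _) _ _ _ _ _ = tt
  LocalInv-transfer (a3t _) _ _ _ _ _ = tt
  LocalInv-transfer (a3r _) _ _ _ _ _ = tt
  LocalInv-transfer (a4 _) _ _ _ _ _ = tt
  LocalInv-transfer (r1 _) _ _ _ _ _ = tt
  LocalInv-transfer (r2 _) _ _ _ _ _ = tt
  LocalInv-transfer (b0 _) _ _ _ _ _ = tt
  LocalInv-transfer (b1 _) _ _ _ _ _ = tt

  record Inv (s : S) : Set where
    field
      critical-unique : ∀ i j → InCritical (threads s i) → InCritical (threads s j) → i ≡ j
      critical-locked : lock s ≡ false → ∀ i → ¬ InCritical (threads s i)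
      local-inv : ∀ i → LocalInv s (threads s i)
      descriptor-issued : ∀ d r → removeOp s ≡ just (d , r) → d < counter s
      nonSpanning-connected : ∀ e → status s e ≡ NONSPANNING → Connected (forest s) e
      claims-bounded : ∀ e → claims s e ≤ ms s e
  open Inv

  Inv-init : Inv initState
  Inv-init = record
    { critical-unique = λ _ _ ()
    ; critical-locked = λ _ _ ()
    ; local-inv = λ _ → tt
    ; descriptor-issued = λ _ _ ()
    ; nonSpanning-connected = λ _ ()
    ; claims-bounded = λ _ → ≤-reflexive (sum-replicate-zero T) }

  local-inv-at : ∀ {s} → Inv s → ∀ {j l} → threads s j ≡ l → LocalInv s l
  local-inv-at {s} I {j} eq = subst (LocalInv s) eq (local-inv I j)

  -- Preservation by single steps

  setT-same : ∀ (s : S) i l → setT s i l i ≡ l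
  setT-same s = upd-same (threads s)

  setT-other : ∀ (s : S) {i} l {j} → j ≢ i → setT s i l j ≡ threads s j
  setT-other s = upd-other (threads s)

  claims-step : ∀ (s s′ : S) i → (∀ {j} → j ≢ i → threads s′ j ≡ threads s j) → ∀ e → claims s e ≤ ms s e →
    nonSpanning (status s′ e) + holds e (threads s′ i) + ms s e ≤
    nonSpanning (status s e) + holds e (threads s i) + ms s′ e →
    claims s′ e ≤ ms s′ e
  claims-step s s′ i others e =
    ≤-transfer _ (sum (holds e ∘ threads s′)) _ _ (sum (holds e ∘ threads s)) _ _ _
      (sum-update (holds e ∘ threads s) (holds e ∘ threads s′) i (λ j j≢i → cong (holds e) (others j≢i)))

  localStep : S → (Fin m → ℕ) → (Fin m → Status) → (Fin m → Bool) → Fin T → Local m → S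
  localStep s M St X i l′ = record s { ms = M ; status = St ; started = X ; threads = setT s i l′ }

  -- A fresh non-spanning mark cannot endanger a search: the marking thread bypasses every
  -- descriptor (and is therefore covered by it), or no search can be running concurrently.
  FreshMark : S → Fin T → Fin m → Set
  FreshMark s i x = status s x ≡ INITIAL × Connected (forest s) x ×
                    ((∀ d → Bypasses d x (threads s i)) ⊎ lock s ≡ false ⊎ InCritical (threads s i))

  module UnlockedStep {s : S} (I : Inv s) (M : Fin m → ℕ) (St : Fin m → Status) (X : Fin m → Bool)
    (i : Fin T) (l′ : Local m)
    (still-initial : ∀ x → St x ≡ INITIAL → status s x ≡ INITIAL)
    (marked : ∀ x → St x ≡ NONSPANNING → status s x ≡ NONSPANNING ⊎ FreshMark s i x)
    (bypassing : ∀ d r e → removeOp s ≡ just (d , r) → slots s d ≡ null ⊎ slots s d ≡ DONE →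
                 Bypasses d e l′ → Bypasses d e (threads s i) ⊎ Survives (forest s) r e)
    where

    s′ : S
    s′ = localStep s M St X i l′

    SafeVisits-preserved : ∀ j → j ≢ i → InCritical (threads s j) → ∀ d r V → removeOp s ≡ just (d , r) →
      slots s d ≡ null ⊎ slots s d ≡ DONE →
      SafeVisits (status s) (forest s) (threads s) d r V → SafeVisits St (forest s) (threads s′) d r V
    SafeVisits-preserved j j≢i j-critical d r V op slot safe e Ve = nonSpanning-case , initial-case
      where
      nonSpanning-case : St e ≡ NONSPANNING → Survives (forest s) r e
      nonSpanning-case ns with marked e ns
      ... | inj₁ old = proj₁ (safe e Ve) old
      ... | inj₂ (initial , _ , inj₁ bypass) = proj₂ (safe e Ve) initial i (bypass d)
      ... | inj₂ (_ , _ , inj₂ (inj₁ unlocked)) = ⊥-elim (critical-locked I unlocked j j-critical)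
      ... | inj₂ (_ , _ , inj₂ (inj₂ i-critical)) = ⊥-elim (j≢i (critical-unique I j i j-critical i-critical))
      initial-case : St e ≡ INITIAL → ∀ k → Bypasses d e (setT s i l′ k) → Survives (forest s) r e
      initial-case initial k bypass with k ≟ i
      ... | yes refl = [ proj₂ (safe e Ve) (still-initial e initial) i , id ]′ (bypassing d r e op slot bypass)
      ... | no _ = proj₂ (safe e Ve) (still-initial e initial) k bypass

    LocalInv-preserved : ∀ j → j ≢ i → LocalInv s (threads s j) → LocalInv s′ (threads s j)
    LocalInv-preserved j j≢i = LocalInv-transfer (threads s j)
      (λ e _ inv initial → inv (still-initial e initial))
      (λ _ _ _ _ inv → inv)
      (λ r d V eq (op , search , found) →
        op , (λ empty → SafeVisits-preserved j j≢i (critical eq) d r V op (inj₁ empty) (search empty)) , found)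
      (λ { r nothing eq (d , op , done , safe) →
             d , op , done , SafeVisits-preserved j j≢i (critical eq) d r _ op (inj₂ done) safe
         ; r (just e) eq inv → inv })
      where
      critical : ∀ {l} → threads s j ≡ l → {{InCritical l}} → InCritical (threads s j)
      critical refl {{c}} = c

    unlocked-step : (InCritical l′ → InCritical (threads s i)) → LocalInv s′ l′ →
      (∀ e → nonSpanning (St e) + holds e l′ + ms s e ≤ nonSpanning (status s e) + holds e (threads s i) + M e) →
      Inv s′
    unlocked-step still-critical inv claims-local = record
      { critical-unique = λ a b ca cb → critical-unique I a b (was-critical a ca) (was-critical b cb)
      ; critical-locked = λ unlocked a ca → critical-locked I unlocked a (was-critical a ca)
      ; local-inv = local
      ; descriptor-issued = descriptor-issued I
      ; nonSpanning-connected = connected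
      ; claims-bounded = λ e → claims-step s s′ i (setT-other s l′) e (claims-bounded I e)
          (subst (λ l → nonSpanning (St e) + holds e l + ms s e ≤ _) (sym (setT-same s i l′)) (claims-local e)) }
      where
      was-critical : ∀ j → InCritical (setT s i l′ j) → InCritical (threads s j)
      was-critical j c with j ≟ i
      ... | yes refl = still-critical c
      ... | no _ = c
      local : ∀ j → LocalInv s′ (setT s i l′ j)
      local j with j ≟ i
      ... | yes refl = inv
      ... | no j≢i = LocalInv-preserved j j≢i (local-inv I j)
      connected : ∀ e → St e ≡ NONSPANNING → Connected (forest s) e
      connected e ns with marked e ns
      ... | inj₁ old = nonSpanning-connected I e old
      ... | inj₂ (_ , c , _) = c

  claims-critical : ∀ {s} (I : Inv s) (s′ : S) i {l l′} → threads s i ≡ l → threads s′ ≡ setT s i l′ →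
    (∀ e → holds e l ≡ 0) → (∀ e → holds e l′ ≡ 0) →
    (∀ e → nonSpanning (status s′ e) + ms s e ≤ nonSpanning (status s e) + ms s′ e) →
    ∀ e → claims s′ e ≤ ms s′ e
  claims-critical {s} I s′ i {l} {l′} eq refl nothing-before nothing-after local e =
    claims-step s s′ i (setT-other s l′) e (claims-bounded I e)
      (subst₂ (λ h h′ → nonSpanning (status s′ e) + h + ms s e ≤ nonSpanning (status s e) + h′ + ms s′ e)
              (sym (trans (cong (holds e) (setT-same s i l′)) (nothing-after e)))
              (sym (trans (cong (holds e) eq) (nothing-before e)))
              (+0-≤ _ (ms s e) _ (ms s′ e) (local e)))

  exclusive-step : ∀ {s} (I : Inv s) (s′ : S) i {l l′} → threads s i ≡ l → threads s′ ≡ setT s i l′ →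
    (∀ {j} → j ≢ i → ¬ InCritical (threads s j)) →
    (∀ {j e} → j ≢ i → threads s j ≡ a5 e → LocalInv s′ (a5 e)) →
    (∀ {j e d r} → j ≢ i → threads s j ≡ a3c e d r → LocalInv s′ (a3c e d r)) →
    LocalInv s′ l′ →
    (lock s′ ≡ false → ¬ InCritical l′) →
    (∀ d r → removeOp s′ ≡ just (d , r) → d < counter s′) →
    (∀ e → status s′ e ≡ NONSPANNING → Connected (forest s′) e) →
    (∀ e → holds e l ≡ 0) → (∀ e → holds e l′ ≡ 0) →
    (∀ e → nonSpanning (status s′ e) + ms s e ≤ nonSpanning (status s e) + ms s′ e) →
    Inv s′
  exclusive-step {s} I s′ i {l} {l′} eq refl others-outside a5-inv a3c-inv inv unlocked issued connected
                 nothing-before nothing-after claims-local = record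
    { critical-unique = λ a b ca cb → trans (only-i a ca) (sym (only-i b cb))
    ; critical-locked = locked
    ; local-inv = local
    ; descriptor-issued = issued
    ; nonSpanning-connected = connected
    ; claims-bounded = claims-critical I s′ i eq refl nothing-before nothing-after claims-local }
    where
    only-i : ∀ j → InCritical (setT s i l′ j) → j ≡ i
    only-i j c with j ≟ i
    ... | yes j≡i = j≡i
    ... | no j≢i = ⊥-elim (others-outside j≢i c)
    locked : lock s′ ≡ false → ∀ j → ¬ InCritical (setT s i l′ j)
    locked free j c with j ≟ i
    ... | yes _ = unlocked free c
    ... | no j≢i = others-outside j≢i c
    local : ∀ j → LocalInv s′ (setT s i l′ j)
    local j with j ≟ i
    ... | yes _ = inv
    ... | no j≢i = LocalInv-transfer (threads s j)
      (λ _ eq _ → a5-inv j≢i eq)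
      (λ _ _ _ eq _ → a3c-inv j≢i eq)
      (λ _ _ _ eq _ → ⊥-elim (others-outside j≢i (subst InCritical (sym eq) tt)))
      (λ _ _ eq _ → ⊥-elim (others-outside j≢i (subst InCritical (sym eq) tt)))
      (local-inv I j)

  bypasses-holds : ∀ d e l → Bypasses d e l → holds e l ≡ 1
  bypasses-holds d e (a4 e) refl = copies-self e
  bypasses-holds d e (a5 e) refl = copies-self e
  bypasses-holds d e (a3c e _ _) (refl , _) = copies-self e

  nonSpanning≤ms : ∀ {s} → Inv s → ∀ e → nonSpanning (status s e) ≤ ms s e
  nonSpanning≤ms I e = ≤-trans (m≤m+n _ _) (claims-bounded I e)

  holds≤ms : ∀ {s} → Inv s → ∀ e j → holds e (threads s j) ≤ ms s e
  holds≤ms {s} I e j = ≤-trans (≤-sum (holds e ∘ threads s) j) (≤-trans (m≤n+m _ _) (claims-bounded I e))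

  absent⇒¬nonSpanning : ∀ {s} → Inv s → ∀ {e} → ms s e ≡ 0 → status s e ≢ NONSPANNING
  absent⇒¬nonSpanning I {e} absent ns = n≮0 (subst₂ _≤_ (cong nonSpanning ns) absent (nonSpanning≤ms I e))

  absent⇒¬bypassed : ∀ {s} → Inv s → ∀ {e} → ms s e ≡ 0 → ∀ d j → ¬ Bypasses d e (threads s j)
  absent⇒¬bypassed {s} I {e} absent d j b =
    n≮0 (subst₂ _≤_ (bypasses-holds d e (threads s j) b) absent (holds≤ms I e j))

  SafeVisits-weaken : ∀ {St F Th Th′ d r V V′} → (∀ e → V′ e ≡ true → V e ≡ true) →
    (∀ k {e} → Bypasses d e (Th′ k) → Bypasses d e (Th k)) →
    SafeVisits St F Th d r V → SafeVisits St F Th′ d r V′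
  SafeVisits-weaken V′⊆V bypass safe e V′e =
    proj₁ (safe e (V′⊆V e V′e)) , λ initial k b → proj₂ (safe e (V′⊆V e V′e)) initial k (bypass k b)

  SafeVisits-visit : ∀ {St₀ St F Th Th′ d r V e} → (∀ x → x ≢ e → St x ≡ St₀ x) →
    (∀ k {x} → Bypasses d x (Th′ k) → Bypasses d x (Th k)) →
    SafeVisits St₀ F Th d r V → EdgeSafe St F Th d r e → SafeVisits St F Th′ d r (upd V e true)
  SafeVisits-visit {e = e} same bypass safe safe-e x Vx with x ≟ e
  ... | yes refl = proj₁ safe-e , λ initial k b → proj₂ safe-e initial k (bypass k b)
  ... | no x≢e rewrite same x x≢e = proj₁ (safe x Vx) , λ initial k b → proj₂ (safe x Vx) initial k (bypass k b)

  setT-bypasses : ∀ (s : S) i {l′} → (∀ {d e} → ¬ Bypasses d e l′) →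
    ∀ {d} k {e} → Bypasses d e (setT s i l′ k) → Bypasses d e (threads s k)
  setT-bypasses s i l′-bypasses-nothing k b with k ≟ i
  ... | yes refl = ⊥-elim (l′-bypasses-nothing b)
  ... | no _ = b

  local-move : ∀ {s} → Inv s → ∀ X i {l l′} → threads s i ≡ l →
    (∀ e → holds e l′ ≤ holds e l) → (InCritical l′ → InCritical l) →
    LocalInv (localStep s (ms s) (status s) X i l′) l′ →
    (∀ d r e → removeOp s ≡ just (d , r) → slots s d ≡ null ⊎ slots s d ≡ DONE →
               Bypasses d e l′ → Bypasses d e l ⊎ Survives (forest s) r e) →
    Inv (localStep s (ms s) (status s) X i l′)
  local-move {s} I X i refl fewer critical inv bypassing =
    UnlockedStep.unlocked-step I (ms s) (status s) X i _ (λ _ → id) (λ _ → inj₁) bypassing critical inv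
      (λ e → +-monoˡ-≤ (ms s e) (+-monoʳ-≤ (nonSpanning (status s e)) (fewer e)))

  data Quiet : Local m → Set where
    idle : Quiet idle
    a1 : ∀ e → Quiet (a1 e)
    ablk : ∀ e → Quiet (ablk e)
    a2 : ∀ e → Quiet (a2 e)
    a3t : ∀ e → Quiet (a3t e)
    r1 : ∀ e → Quiet (r1 e)
    b0 : ∀ e → Quiet (b0 e)

  Quiet⇒holds≡0 : ∀ {l} → Quiet l → ∀ e → holds e l ≡ 0
  Quiet⇒¬Bypasses : ∀ {l} → Quiet l → ∀ {d e} → ¬ Bypasses d e l
  Quiet⇒¬InCritical : ∀ {l} → Quiet l → ¬ InCritical l
  Quiet⇒LocalInv : ∀ {s l} → Quiet l → LocalInv s l
  Quiet⇒holds≡0 = λ { idle _ → refl ; (a1 _) _ → refl ; (ablk _) _ → refl ; (a2 _) _ → refl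
                    ; (a3t _) _ → refl ; (r1 _) _ → refl ; (b0 _) _ → refl }
  Quiet⇒¬Bypasses = λ { idle () ; (a1 _) () ; (ablk _) () ; (a2 _) () ; (a3t _) () ; (r1 _) () ; (b0 _) () }
  Quiet⇒¬InCritical = λ { idle () ; (a1 _) () ; (ablk _) () ; (a2 _) () ; (a3t _) () ; (r1 _) () ; (b0 _) () }
  Quiet⇒LocalInv = λ { idle → tt ; (a1 _) → tt ; (ablk _) → tt ; (a2 _) → tt
                     ; (a3t _) → tt ; (r1 _) → tt ; (b0 _) → tt }

  quiet-move : ∀ {s} → Inv s → ∀ X i {l l′} → threads s i ≡ l → Quiet l′ →
    Inv (localStep s (ms s) (status s) X i l′)
  quiet-move I X i eq quiet =
    local-move I X i eq (λ e → subst (_≤ _) (sym (Quiet⇒holds≡0 quiet e)) z≤n)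
      (⊥-elim ∘ Quiet⇒¬InCritical quiet)
      (Quiet⇒LocalInv quiet) (λ _ _ _ _ _ b → ⊥-elim (Quiet⇒¬Bypasses quiet b))

  release-copy : ∀ {s} → Inv s → ∀ i e {l l′} → threads s i ≡ l → heldEdge l ≡ just e → Quiet l′ →
    Inv (localStep s (msRemove (ms s) e) (status s) (started s) i l′)
  release-copy {s} I i e {l} {l′} refl held quiet =
    UnlockedStep.unlocked-step I (msRemove (ms s) e) (status s) (started s) i l′ (λ _ → id) (λ _ → inj₁)
      (λ _ _ _ _ _ b → ⊥-elim (Quiet⇒¬Bypasses quiet b)) (⊥-elim ∘ Quiet⇒¬InCritical quiet)
      (Quiet⇒LocalInv quiet)
      claims-local
    where
    claims-local : ∀ x → nonSpanning (status s x) + holds x l′ + ms s x ≤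
                         nonSpanning (status s x) + holds x l + msRemove (ms s) e x
    claims-local x rewrite Quiet⇒holds≡0 quiet x | held with x ≟ e
    ... | yes refl rewrite copies-self x = copy-released (nonSpanning (status s x)) (ms s x)
    ... | no x≢e rewrite copies-other {x} (x≢e ∘ sym) = ≤-refl

  visit-step : ∀ {s} → Inv s → ∀ i {r d V} e M St → threads s i ≡ bs r d V →
    (∀ x → x ≢ e → St x ≡ status s x) →
    (∀ x → St x ≡ INITIAL → status s x ≡ INITIAL) →
    (∀ x → St x ≡ NONSPANNING → status s x ≡ NONSPANNING ⊎ FreshMark s i x) →
    EdgeSafe St (forest s) (threads s) d r e →
    (∀ x → nonSpanning (St x) + ms s x ≤ nonSpanning (status s x) + M x) →
    Inv (localStep s M St (started s) i (bs r d (upd V e true)))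
  visit-step {s} I i {r} {d} {V} e M St eq same still-initial marked safe-e claims-local =
    UnlockedStep.unlocked-step I M St (started s) i _ still-initial marked (λ _ _ _ _ _ ())
      (λ _ → subst InCritical (sym eq) tt)
      (op , (λ empty → SafeVisits-visit same (setT-bypasses s i λ ()) (search empty) safe-e) , found)
      (λ x → subst (λ l → nonSpanning (St x) + 0 + ms s x ≤ nonSpanning (status s x) + holds x l + M x) (sym eq)
                   (+0-≤ _ (ms s x) _ (M x) (claims-local x)))
    where
    op = proj₁ (local-inv-at I eq)
    search = proj₁ (proj₂ (local-inv-at I eq))
    found = proj₂ (proj₂ (local-inv-at I eq))

  op-injective : ∀ {x : Maybe (ℕ × Fin m)} {d d′ r r′} → x ≡ just (d , r) → x ≡ just (d′ , r′) →
                 d ≡ d′ × r ≡ r′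
  op-injective refl refl = refl , refl

  edge-injective : ∀ {e e′ : Fin m} → edge e ≡ edge e′ → e ≡ e′
  edge-injective refl = refl

  alone-in-critical : ∀ {s} → Inv s → ∀ {i l} → threads s i ≡ l → {{InCritical l}} →
    ∀ {j} → j ≢ i → ¬ InCritical (threads s j)
  alone-in-critical I {i} eq {{c}} {j} j≢i cj = j≢i (critical-unique I j i cj (subst InCritical (sym eq) c))

  nonReplacement-bypass : ∀ {s} → Inv s → ∀ {i e d r} → threads s i ≡ a3c e d r → ¬ CanReplace (forest s) r e →
    ∀ d′ r′ e′ → removeOp s ≡ just (d′ , r′) → Bypasses d′ e′ (a4 e) →
    Bypasses d′ e′ (a3c e d r) ⊎ Survives (forest s) r′ e′
  nonReplacement-bypass I {e = e} {d} {r} eq ¬cr d′ r′ e′ op refl with d ≟ℕ d′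
  ... | no d≢d′ = inj₁ (refl , d≢d′)
  ... | yes refl with proj₂ (local-inv-at I eq) r′ op
  ...   | refl = inj₂ (¬CanReplace⇒Survives _ r e ¬cr)

  taken-slot-differs : ∀ {s : S} {d d′ e₁} → slots s d ≡ edge e₁ →
                       slots s d′ ≡ null ⊎ slots s d′ ≡ DONE → d ≢ d′
  taken-slot-differs taken (inj₁ empty) refl = case trans (sym taken) empty of λ ()
  taken-slot-differs taken (inj₂ done) refl = case trans (sym taken) done of λ ()

  acquire-lock : ∀ {s} → Inv s → ∀ {i r} → threads s i ≡ b0 r → lock s ≡ false →
    Inv (record s { lock = true ; threads = setT s i (b1 r) })
  acquire-lock I eq free =
    exclusive-step I _ _ eq refl (λ _ → critical-locked I free _) (λ _ → local-inv-at I) (λ _ → local-inv-at I)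
      tt (λ ()) (descriptor-issued I) (nonSpanning-connected I) (λ _ → refl) (λ _ → refl) (λ _ → ≤-refl)

  release-lock : ∀ {s} → Inv s → ∀ {i r} → threads s i ≡ b1 r →
    Inv (record s { lock = false ; threads = setT s i idle })
  release-lock I eq =
    exclusive-step I _ _ eq refl (alone-in-critical I eq) (λ _ → local-inv-at I) (λ _ → local-inv-at I)
      tt (λ _ ()) (descriptor-issued I) (nonSpanning-connected I) (λ _ → refl) (λ _ → refl) (λ _ → ≤-refl)

  publish : ∀ {s} → Inv s → ∀ {i r} → threads s i ≡ b1 r →
    Inv (record s { removeOp = just (counter s , r) ; slots = updℕ (slots s) (counter s) null
                  ; counter = suc (counter s) ; threads = setT s i (bs r (counter s) (λ _ → false)) })
  publish {s} I {i} {r} eq =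
    exclusive-step I _ _ eq refl (alone-in-critical I eq) (λ _ → local-inv-at I) older-check
      (refl , (λ _ _ ()) , λ e taken → case trans (sym (updℕ-same (slots s) (counter s) null)) taken of λ ())
      (λ free _ → critical-locked I free i (subst InCritical (sym eq) tt)) issued (nonSpanning-connected I)
      (λ _ → refl) (λ _ → refl) (λ _ → ≤-refl)
    where
    older-check : ∀ {j e d r′} → j ≢ i → threads s j ≡ a3c e d r′ →
      d < suc (counter s) × (∀ r″ → just (counter s , r) ≡ just (d , r″) → r″ ≡ r′)
    older-check _ eq′ with local-inv-at I eq′
    ... | d<counter , _ = m<n⇒m<1+n d<counter ,
                          λ _ p → ⊥-elim (<-irrefl (sym (proj₁ (op-injective refl p))) d<counter)
    issued : ∀ d r′ → just (counter s , r) ≡ just (d , r′) → d < suc (counter s)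
    issued d r′ p with op-injective refl p
    ... | refl , _ = ≤-refl

  finish-search-found : ∀ {s} → Inv s → ∀ {i r d V e} → threads s i ≡ bs r d V → slots s d ≡ edge e →
    Inv (record s { slots = updℕ (slots s) d DONE ; threads = setT s i (bf r (just e)) })
  finish-search-found {s} I {i} {d = d} {e = e} eq taken =
    exclusive-step I _ _ eq refl (alone-in-critical I eq) (λ _ → local-inv-at I) (λ _ → local-inv-at I)
      (d , op , updℕ-same (slots s) d DONE , found e taken)
      (λ free _ → critical-locked I free i (subst InCritical (sym eq) tt)) (descriptor-issued I)
      (nonSpanning-connected I) (λ _ → refl) (λ _ → refl) (λ _ → ≤-refl)
    where
    op = proj₁ (local-inv-at I eq)
    found = proj₂ (proj₂ (local-inv-at I eq))

  finish-search-exhausted : ∀ {s} → Inv s → ∀ {i r d V} → threads s i ≡ bs r d V → slots s d ≡ null →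
    (∀ e → V e ≡ true) →
    Inv (record s { slots = updℕ (slots s) d DONE ; threads = setT s i (bf r nothing) })
  finish-search-exhausted {s} I {i} {d = d} eq empty all-visited =
    exclusive-step I _ _ eq refl (alone-in-critical I eq) (λ _ → local-inv-at I) (λ _ → local-inv-at I)
      (d , op , updℕ-same (slots s) d DONE ,
       SafeVisits-weaken (λ e _ → all-visited e) (setT-bypasses s i λ ()) (search empty))
      (λ free _ → critical-locked I free i (subst InCritical (sym eq) tt)) (descriptor-issued I)
      (nonSpanning-connected I) (λ _ → refl) (λ _ → refl) (λ _ → ≤-refl)
    where
    op = proj₁ (local-inv-at I eq)
    search = proj₁ (proj₂ (local-inv-at I eq))

  take-replacement : ∀ {s} → Inv s → ∀ {i r d V e} M → threads s i ≡ bs r d V → CanReplace (forest s) r e →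
    (∀ x → nonSpanning (upd (status s) e SPANNING x) + ms s x ≤ nonSpanning (status s x) + M x) →
    Inv (record s { status = upd (status s) e SPANNING ; ms = M ; slots = updℕ (slots s) d (edge e)
                  ; threads = setT s i (bs r d (upd V e true)) })
  take-replacement {s} I {i} {r} {d} {e = e} M eq cr claims-local =
    exclusive-step I _ _ eq refl (alone-in-critical I eq)
      (λ _ eq′ initial → local-inv-at I eq′ (upd-reflects (status s) e _ (λ ()) initial)) (λ _ → local-inv-at I)
      (op , (λ empty → case trans (sym empty) installed of λ ()) ,
            λ e′ taken → subst (CanReplace (forest s) r) (edge-injective (trans (sym installed) taken)) cr)
      (λ free _ → critical-locked I free i (subst InCritical (sym eq) tt)) (descriptor-issued I)
      (λ x ns → nonSpanning-connected I x (upd-reflects (status s) e x (λ ()) ns))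
      (λ _ → refl) (λ _ → refl) claims-local
    where
    op = proj₁ (local-inv-at I eq)
    installed = updℕ-same (slots s) d (edge e)

  add-spanning : ∀ {s} → Inv s → ∀ {i e} → threads s i ≡ ablk e → lock s ≡ false →
    Inv (record s { forest = with+ (forest s) e ; status = upd (status s) e SPANNING ; threads = setT s i idle })
  add-spanning {s} I {e = e} eq free =
    exclusive-step I _ _ eq refl (λ _ → critical-locked I free _)
      (λ _ eq′ initial → grow (local-inv-at I eq′ (upd-reflects (status s) e _ (λ ()) initial))) (λ _ → local-inv-at I)
      tt (λ _ ()) (descriptor-issued I)
      (λ x ns → grow (nonSpanning-connected I x (upd-reflects (status s) e x (λ ()) ns)))
      (λ _ → refl) (λ _ → refl) (λ x → +-monoˡ-≤ (ms s x) (nonSpanning-upd-≤ (status s) e (λ ()) x))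
    where
    grow = Conn-mono (with+-⊇ (forest s) e)

  apply-replacement : ∀ {s} → Inv s → ∀ {i r e} → threads s i ≡ bf r (just e) →
    Inv (record s { forest = with+ (without (forest s) r) e ; status = upd (status s) r REMOVED
                  ; removeOp = nothing ; lock = false ; threads = setT s i idle })
  apply-replacement {s} I {r = r} eq with local-inv-at I eq
  ... | _ , _ , _ , cr =
    exclusive-step I _ _ eq refl (alone-in-critical I eq)
      (λ _ eq′ initial → Conn-replace cr (local-inv-at I eq′ (upd-reflects (status s) r _ (λ ()) initial)))
      (λ _ eq′ → proj₁ (local-inv-at I eq′) , λ _ ())
      tt (λ _ ()) (λ _ _ ()) (λ x ns → Conn-replace cr (nonSpanning-connected I x (upd-reflects (status s) r x (λ ()) ns)))
      (λ _ → refl) (λ _ → refl) (λ x → +-monoˡ-≤ (ms s x) (nonSpanning-upd-≤ (status s) r (λ ()) x))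

  apply-split : ∀ {s} → Inv s → ∀ {i r} → threads s i ≡ bf r nothing →
    Inv (record s { forest = without (forest s) r ; status = upd (status s) r REMOVED
                  ; removeOp = nothing ; lock = false ; threads = setT s i idle })
  apply-split {s} I {r = r} eq with local-inv-at I eq
  ... | d , _ , _ , safe =
    exclusive-step I _ _ eq refl (alone-in-critical I eq)
      (λ {_} {e} _ eq′ initial →
        let initial₀ = upd-reflects (status s) r _ (λ ()) initial in
        proj₂ (safe e refl) initial₀ _ (subst (Bypasses d e) (sym eq′) refl) (local-inv-at I eq′ initial₀))
      (λ _ eq′ → proj₁ (local-inv-at I eq′) , λ _ ())
      tt (λ _ ()) (λ _ _ ())
      (λ x ns → let ns₀ = upd-reflects (status s) r x (λ ()) ns in
                proj₁ (safe x refl) ns₀ (nonSpanning-connected I x ns₀))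
      (λ _ → refl) (λ _ → refl) (λ x → +-monoˡ-≤ (ms s x) (nonSpanning-upd-≤ (status s) r (λ ()) x))

  install-replacement : ∀ {s} → Inv s → ∀ {i e d r} → threads s i ≡ a3c e d r → CanReplace (forest s) r e →
    slots s d ≡ null → Inv (record s { slots = updℕ (slots s) d (edge e) ; threads = setT s i (a3s e) })
  install-replacement {s} I {i} {e} {d} {r} eq cr empty = record
    { critical-unique = λ a b ca cb → critical-unique I a b (was-critical a ca) (was-critical b cb)
    ; critical-locked = λ free a ca → critical-locked I free a (was-critical a ca)
    ; local-inv = local
    ; descriptor-issued = descriptor-issued I
    ; nonSpanning-connected = nonSpanning-connected I
    ; claims-bounded = λ x → claims-step s s′ i (setT-other s (a3s e)) x (claims-bounded I x) (claims-local x) }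
    where
    s′ : S
    s′ = record s { slots = updℕ (slots s) d (edge e) ; threads = setT s i (a3s e) }
    installed : ∀ {e′} → slots s′ d ≡ edge e′ → e ≡ e′
    installed taken = edge-injective (trans (sym (updℕ-same (slots s) d (edge e))) taken)
    other-slot : ∀ {d′} → d′ ≢ d → slots s′ d′ ≡ slots s d′
    other-slot = updℕ-other (slots s) (edge e)
    was-critical : ∀ j → InCritical (setT s i (a3s e) j) → InCritical (threads s j)
    was-critical j c with j ≟ i
    ... | no _ = c
    claims-local : ∀ x → nonSpanning (status s x) + holds x (setT s i (a3s e) i) + ms s x ≤
                         nonSpanning (status s x) + holds x (threads s i) + ms s x
    claims-local x rewrite setT-same s i (a3s e) | eq = ≤-refl
    unaffected : ∀ {d′ r′ V} → SafeVisits (status s) (forest s) (threads s) d′ r′ V →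
                 SafeVisits (status s) (forest s) (threads s′) d′ r′ V
    unaffected = SafeVisits-weaken (λ _ → id) (setT-bypasses s i λ ())
    searching : ∀ r′ d′ V → LocalInv s (bs r′ d′ V) → LocalInv s′ (bs r′ d′ V)
    searching r′ d′ V (op , search , found) with d′ ≟ℕ d
    ... | yes refl = op , (λ empty′ → case trans (sym empty′) (updℕ-same (slots s) d (edge e)) of λ ()) ,
                     λ e′ taken → subst₂ (CanReplace (forest s)) (sym (proj₂ (local-inv-at I eq) r′ op))
                                          (installed taken) cr
    ... | no d′≢d = op , (λ empty′ → unaffected (search (trans (sym (other-slot d′≢d)) empty′))) ,
                    λ e′ taken → found e′ (trans (sym (other-slot d′≢d)) taken)
    finishing : ∀ r′ x → LocalInv s (bf r′ x) → LocalInv s′ (bf r′ x)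
    finishing r′ x (d′ , op , done , outcome) with d′ ≟ℕ d
    ... | yes refl = case trans (sym empty) done of λ ()
    finishing r′ nothing (d′ , op , done , safe) | no d′≢d = d′ , op , trans (other-slot d′≢d) done , unaffected safe
    finishing r′ (just _) (d′ , op , done , cr′) | no d′≢d = d′ , op , trans (other-slot d′≢d) done , cr′
    local : ∀ j → LocalInv s′ (setT s i (a3s e) j)
    local j with j ≟ i
    ... | yes _ = tt
    ... | no _ = LocalInv-transfer (threads s j) (λ _ _ inv → inv) (λ _ _ _ _ inv → inv)
                   (λ r′ d′ V _ → searching r′ d′ V) (λ r′ x _ → finishing r′ x) (local-inv I j)

  insert-copy : ∀ {s} → Inv s → ∀ {i e} → threads s i ≡ a2 e →
    Inv (localStep s (msInsert (ms s) e) (status s) (started s) i (a3 e))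
  insert-copy {s} I {i} {e} eq =
    UnlockedStep.unlocked-step I (msInsert (ms s) e) (status s) (started s) i (a3 e) (λ _ → id) (λ _ → inj₁)
      (λ _ _ _ _ _ ()) (λ ()) tt claims-local
    where
    claims-local : ∀ x → nonSpanning (status s x) + holds x (a3 e) + ms s x ≤
                         nonSpanning (status s x) + holds x (threads s i) + msInsert (ms s) e x
    claims-local x rewrite eq with x ≟ e
    ... | yes refl rewrite copies-self x = copy-inserted _ _
    ... | no x≢e rewrite copies-other (x≢e ∘ sym) = ≤-refl

  mark-nonSpanning-locked : ∀ {s} → Inv s → ∀ {i e} → threads s i ≡ ablk e → lock s ≡ false →
    status s e ≡ INITIAL → Connected (forest s) e →
    Inv (localStep s (msInsert (ms s) e) (upd (status s) e NONSPANNING) (started s) i idle)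
  mark-nonSpanning-locked {s} I {i} {e} eq free initial c =
    UnlockedStep.unlocked-step I (msInsert (ms s) e) (upd (status s) e NONSPANNING) (started s) i idle
      (λ x → upd-reflects (status s) e x (λ ())) marked (λ _ _ _ _ _ ()) (λ ()) tt claims-local
    where
    marked : ∀ x → upd (status s) e NONSPANNING x ≡ NONSPANNING → status s x ≡ NONSPANNING ⊎ FreshMark s i x
    marked x ns with x ≟ e
    ... | yes refl = inj₂ (initial , c , inj₂ (inj₁ free))
    ... | no _ = inj₁ ns
    claims-local : ∀ x → nonSpanning (upd (status s) e NONSPANNING x) + 0 + ms s x ≤
                         nonSpanning (status s x) + holds x (threads s i) + msInsert (ms s) e x
    claims-local x rewrite eq with x ≟ e
    ... | yes refl rewrite initial = ≤-refl
    ... | no _ = ≤-refl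

  mark-nonSpanning-checked : ∀ {s} → Inv s → ∀ {i e} → threads s i ≡ a5 e → status s e ≡ INITIAL →
    Inv (localStep s (ms s) (upd (status s) e NONSPANNING) (started s) i idle)
  mark-nonSpanning-checked {s} I {i} {e} eq initial =
    UnlockedStep.unlocked-step I (ms s) (upd (status s) e NONSPANNING) (started s) i idle
      (λ x → upd-reflects (status s) e x (λ ())) marked (λ _ _ _ _ _ ()) (λ ()) tt claims-local
    where
    marked : ∀ x → upd (status s) e NONSPANNING x ≡ NONSPANNING → status s x ≡ NONSPANNING ⊎ FreshMark s i x
    marked x ns with x ≟ e
    ... | yes refl = inj₂ (initial , local-inv-at I eq initial , inj₁ λ d → subst (Bypasses d x) (sym eq) refl)
    ... | no _ = inj₁ ns
    claims-local : ∀ x → nonSpanning (upd (status s) e NONSPANNING x) + 0 + ms s x ≤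
                         nonSpanning (status s x) + holds x (threads s i) + ms s x
    claims-local x rewrite eq with x ≟ e
    ... | yes refl rewrite initial | copies-self x = ≤-refl
    ... | no x≢e rewrite copies-other (x≢e ∘ sym) = ≤-refl

  mark-spanning : ∀ {s} → Inv s → ∀ {i e} → threads s i ≡ a3t e →
    Inv (localStep s (ms s) (upd (status s) e SPANNING) (started s) i idle)
  mark-spanning {s} I {i} {e} eq =
    UnlockedStep.unlocked-step I (ms s) (upd (status s) e SPANNING) (started s) i idle
      (λ x → upd-reflects (status s) e x (λ ())) (λ x ns → inj₁ (upd-reflects (status s) e x (λ ()) ns))
      (λ _ _ _ _ _ ()) (λ ()) tt claims-local
    where
    claims-local : ∀ x → nonSpanning (upd (status s) e SPANNING x) + 0 + ms s x ≤
                         nonSpanning (status s x) + holds x (threads s i) + ms s x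
    claims-local x rewrite eq = +-monoˡ-≤ (ms s x) (+-monoˡ-≤ 0 (nonSpanning-upd-≤ (status s) e (λ ()) x))

  mark-removed : ∀ {s} → Inv s → ∀ {i e} → threads s i ≡ r1 e → status s e ≡ NONSPANNING →
    Inv (localStep s (ms s) (upd (status s) e REMOVED) (started s) i (r2 e))
  mark-removed {s} I {i} {e} eq ns =
    UnlockedStep.unlocked-step I (ms s) (upd (status s) e REMOVED) (started s) i (r2 e)
      (λ x → upd-reflects (status s) e x (λ ())) (λ x ns′ → inj₁ (upd-reflects (status s) e x (λ ()) ns′))
      (λ _ _ _ _ _ ()) (λ ()) tt claims-local
    where
    claims-local : ∀ x → nonSpanning (upd (status s) e REMOVED x) + holds x (r2 e) + ms s x ≤
                         nonSpanning (status s x) + holds x (threads s i) + ms s x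
    claims-local x rewrite eq with x ≟ e
    ... | yes refl rewrite ns | copies-self x = ≤-refl
    ... | no x≢e rewrite copies-other (x≢e ∘ sym) = ≤-refl

  visit-initial-nonReplacement : ∀ {s} → Inv s → ∀ {i r d V e} → threads s i ≡ bs r d V → status s e ≡ INITIAL →
    ¬ CanReplace (forest s) r e → Connected (forest s) e →
    Inv (localStep s (msInsert (ms s) e) (upd (status s) e NONSPANNING) (started s) i (bs r d (upd V e true)))
  visit-initial-nonReplacement {s} I {i} {r} {e = e} eq initial ¬cr c =
    visit-step I i e (msInsert (ms s) e) (upd (status s) e NONSPANNING) eq (λ _ → upd-other (status s) NONSPANNING)
      (λ x → upd-reflects (status s) e x (λ ())) marked
      ((λ _ → ¬CanReplace⇒Survives _ r e ¬cr) , λ p → case trans (sym (upd-same (status s) e NONSPANNING)) p of λ ())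
      claims-local
    where
    marked : ∀ x → upd (status s) e NONSPANNING x ≡ NONSPANNING → status s x ≡ NONSPANNING ⊎ FreshMark s i x
    marked x ns with x ≟ e
    ... | yes refl = inj₂ (initial , c , inj₂ (inj₂ (subst InCritical (sym eq) tt)))
    ... | no _ = inj₁ ns
    claims-local : ∀ x → nonSpanning (upd (status s) e NONSPANNING x) + ms s x ≤
                         nonSpanning (status s x) + msInsert (ms s) e x
    claims-local x with x ≟ e
    ... | yes refl rewrite initial = ≤-refl
    ... | no _ = ≤-refl

  settled-EdgeSafe : ∀ {St F Th d r e} → St e ≡ SPANNING ⊎ St e ≡ REMOVED → EdgeSafe St F Th d r e
  settled-EdgeSafe (inj₁ sp) = (λ ns → case trans (sym sp) ns of λ ()) , (λ ini → case trans (sym sp) ini of λ ())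
  settled-EdgeSafe (inj₂ rm) = (λ ns → case trans (sym rm) ns of λ ()) , (λ ini → case trans (sym rm) ini of λ ())

  unmark-release : ∀ {s : S} {e} → status s e ≡ NONSPANNING →
    ∀ x → nonSpanning (upd (status s) e SPANNING x) + ms s x ≤ nonSpanning (status s x) + msRemove (ms s) e x
  unmark-release {s} {e} ns x with x ≟ e
  ... | yes refl rewrite ns = m≤n+m∸n (ms s x) 1
  ... | no _ = ≤-refl

  step-inv : ∀ {s s′} → Inv s → Step s s′ → Inv s′
  step-inv I (invAdd i e eq _) = quiet-move I _ i eq (a1 e)
  step-inv I (invRem i e eq) = quiet-move I _ i eq (r1 e)
  step-inv I (a1-no i e eq _) = quiet-move I _ i eq (ablk e)
  step-inv I (a1-yes i e eq _) = quiet-move I _ i eq (a2 e)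
  step-inv I (blk-done i e eq _ _) = quiet-move I _ i eq (idle)
  step-inv I (blk-span i e eq free _ _) = add-spanning I eq free
  step-inv I (blk-nonspan i e eq free initial c) = mark-nonSpanning-locked I eq free initial c
  step-inv I (a2-ins i e eq) = insert-copy I eq
  step-inv I (a3-null i e eq no-op) =
    local-move I _ i eq (λ _ → ≤-refl) (λ ()) tt (λ _ _ _ op _ _ → case trans (sym no-op) op of λ ())
  step-inv I (a3-op i e d r eq op) =
    local-move I _ i eq (λ _ → ≤-refl) (λ ())
      (descriptor-issued I d r op , λ _ op′ → sym (proj₂ (op-injective op op′)))
      (λ _ _ _ op′ _ b → ⊥-elim (proj₂ b (proj₁ (op-injective op op′))))
  step-inv I (a3-norepl i e d r eq ¬cr) =
    local-move I _ i eq (λ _ → ≤-refl) (λ ()) tt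
      (λ d′ r′ e′ op _ → nonReplacement-bypass I eq ¬cr d′ r′ e′ op)
  step-inv I (a3-cas-ok i e d r eq cr empty) = install-replacement I eq cr empty
  step-inv I (a3-cas-done i e d r eq _ _) = local-move I _ i eq (λ _ → ≤-refl) (λ ()) tt (λ _ _ _ _ _ ())
  step-inv {s} I (a3-cas-other i e d r e₁ eq _ taken) =
    local-move I _ i eq (λ _ → ≤-refl) (λ ()) tt
      (λ _ _ _ _ slot refl → inj₁ (refl , taken-slot-differs {s} taken slot))
  step-inv I (a3s-rem i e eq) = release-copy I i e eq refl (a3t e)
  step-inv I (a3t-ok i e eq _) = mark-spanning I eq
  step-inv I (a3t-fail i e eq _) = quiet-move I _ i eq (idle)
  step-inv I (a3r-rem i e eq) = release-copy I i e eq refl (ablk e)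
  step-inv I (a4-no i e eq _) = release-copy I i e eq refl (a1 e)
  step-inv I (a4-yes i e eq c) = local-move I _ i eq (λ _ → ≤-refl) (λ ()) (λ _ → c) (λ _ _ _ _ _ → inj₁)
  step-inv I (a5-ok i e eq initial) = mark-nonSpanning-checked I eq initial
  step-inv I (a5-fail i e eq _) = release-copy I i e eq refl idle
  step-inv I (r1-ns i e eq ns) = mark-removed I eq ns
  step-inv I (r1-sp i e eq _) = quiet-move I _ i eq (b0 e)
  step-inv I (r1-init i e eq _) = quiet-move I _ i eq (idle)
  step-inv I (r1-rem i e eq _) = quiet-move I _ i eq (idle)
  step-inv I (r2-del i e eq) = release-copy I i e eq refl idle
  step-inv I (b0-lock i r eq free) = acquire-lock I eq free
  step-inv I (b1-gone i r eq _) = release-lock I eq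
  step-inv I (b1-publish i r eq _) = publish I eq
  step-inv {s} I (bs-absent i r d V e eq _ _ absent) =
    visit-step I i e (ms s) (status s) eq (λ _ _ → refl) (λ _ → id) (λ _ → inj₁)
      ((λ ns → ⊥-elim (absent⇒¬nonSpanning I absent ns)) , λ _ j b → ⊥-elim (absent⇒¬bypassed I absent d j b))
      (λ _ → ≤-refl)
  step-inv {s} I (bs-init-repl i r d V e eq _ _ _ _ cr) =
    take-replacement I (ms s) eq cr (λ x → +-monoˡ-≤ (ms s x) (nonSpanning-upd-≤ (status s) e (λ ()) x))
  step-inv {s} I (bs-init-ns i r d V e eq _ _ _ initial ¬cr c) = visit-initial-nonReplacement I eq initial ¬cr c
  step-inv {s} I (bs-init-skip i r d V e eq _ _ _ _ _ ¬c) =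
    visit-step I i e (ms s) (status s) eq (λ _ _ → refl) (λ _ → id) (λ _ → inj₁)
      ((λ _ c → ⊥-elim (¬c c)) , λ _ _ _ c → ⊥-elim (¬c c)) (λ _ → ≤-refl)
  step-inv {s} I (bs-ns-repl i r d V e eq _ _ _ ns cr) =
    take-replacement I (msRemove (ms s) e) eq cr (unmark-release {s} ns)
  step-inv {s} I (bs-ns-skip i r d V e eq _ _ _ ns ¬cr) =
    visit-step I i e (ms s) (status s) eq (λ _ _ → refl) (λ _ → id) (λ _ → inj₁)
      ((λ _ → ¬CanReplace⇒Survives _ r e ¬cr) , λ initial → case trans (sym ns) initial of λ ())
      (λ _ → ≤-refl)
  step-inv {s} I (bs-other i r d V e eq _ _ _ settled) =
    visit-step I i e (ms s) (status s) eq (λ _ _ → refl) (λ _ → id) (λ _ → inj₁) (settled-EdgeSafe {status s} settled)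
      (λ _ → ≤-refl)
  step-inv I (bs-end-none i r d V eq empty all-visited) = finish-search-exhausted I eq empty all-visited
  step-inv I (bs-end-repl i r d V e eq taken) = finish-search-found I eq taken
  step-inv I (bf-repl i r e eq) = apply-replacement I eq
  step-inv I (bf-split i r eq) = apply-split I eq

  reachable⇒Inv : ∀ {s} → Reachable s → Inv s
  reachable⇒Inv init = Inv-init
  reachable⇒Inv (next r st) = step-inv (reachable⇒Inv r) st

theorem2 : ∀ {n m : ℕ} (ends : Fin m → Fin n × Fin n) (T : ℕ) (s : State m T) →
    Model.Reachable ends T s → ∀ (e : Fin m) → status s e ≡ NONSPANNING →
    Model.Connected ends T (forest s) e
theorem2 ends T s reachable = Inv.nonSpanning-connected (reachable⇒Inv ends T reachable)
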